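{- For every connected finite graph $G$: there is no full homomorphism from any of $C_3$, $P_4$, $A$ into $G$ if and only if there is a full homomorphism from $G$ into $C_5$. Moreover, the connected graphs $G$ satisfying these equivalent conditions are precisely the monochromes of exact Gallai cliques.
   Context: Graphs are finite, undirected, loopless. A full homomorphism $f:G\to H$ is a vertex map with $v_1v_2\in E_G\iff f(v_1)f(v_2)\in E_H$ for all $v_1,v_2\in V_G$. $C_k$ is the $k$-cycle graph; $P_4$ is the path with vertices $v_0,\dots,v_4$ and edges $v_iv_{i+1}$; $A$ is the graph with vertices $v_0,\dots,v_5$ and edges $v_0v_1,v_1v_2,v_1v_4,v_2v_3,v_3v_4,v_4v_5$. An exact Gallai clique is an edge-colored complete graph in which every triangle has edges of exactly two distinct colors; a monochrome of it is a connected component of the graph formed by all vertices and the edges of one fixed color, regarded as an uncolored graph. -}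

module Defs where

open import Data.Nat using (ℕ; zero; suc; _≡ᵇ_; _≤_)
open import Data.Fin using (Fin; toℕ; _≟_)
open import Data.Bool using (Bool; true; false; _∧_; _∨_; not)
open import Data.Bool.Properties using (∨-comm)
open import Data.List using (List; []; _∷_)
open import Data.Product using (_×_; _,_; Σ; ∃; ∃-syntax)
open import Relation.Nullary using (¬_; yes; no)
open import Relation.Nullary.Decidable using (⌊_⌋)
open import Relation.Binary.PropositionalEquality using (_≡_; refl; sym; cong₂)
open import Data.Empty using (⊥-elim)
open import Function using (Injective)

record Graph : Set where
  field
    n      : ℕ
    adj    : Fin n → Fin n → Bool
    adjSym : ∀ u v → adj u v ≡ adj v u
    irrefl : ∀ v → adj v v ≡ false
open Graph public

Edge : (G : Graph) → Fin (n G) → Fin (n G) → Set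
Edge G u v = adj G u v ≡ true

data Walk (G : Graph) : Fin (n G) → Fin (n G) → Set where
  here : ∀ {u} → Walk G u u
  step : ∀ {u v w} → Edge G u v → Walk G v w → Walk G u w

Connected : Graph → Set
Connected G = (1 ≤ n G) × (∀ u v → Walk G u v)

FullHom : (G H : Graph) → (Fin (n G) → Fin (n H)) → Set
FullHom G H f = ∀ v₁ v₂ → adj G v₁ v₂ ≡ adj H (f v₁) (f v₂)

HasFullHom : Graph → Graph → Set
HasFullHom G H = Σ (Fin (n G) → Fin (n H)) (FullHom G H)

private
  neq : ∀ {k} → Fin k → Fin k → Bool
  neq u v = not ⌊ u ≟ v ⌋

  neq-sym : ∀ {k} (u v : Fin k) → neq u v ≡ neq v u
  neq-sym u v with u ≟ v | v ≟ u
  ... | yes _ | yes _ = refl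
  ... | no _  | no _  = refl
  ... | yes p | no q  = ⊥-elim (q (sym p))
  ... | no p  | yes q = ⊥-elim (p (sym q))

  neq-refl : ∀ {k} (u : Fin k) → neq u u ≡ false
  neq-refl u with u ≟ u
  ... | yes _ = refl
  ... | no p  = ⊥-elim (p refl)

  has : List (ℕ × ℕ) → ℕ → ℕ → Bool
  has [] a b = false
  has ((x , y) ∷ es) a b = ((a ≡ᵇ x) ∧ (b ≡ᵇ y)) ∨ has es a b

mkGraph : (k : ℕ) → List (ℕ × ℕ) → Graph
mkGraph k es = record
  { n = k
  ; adj = λ u v → neq u v ∧ (has es (toℕ u) (toℕ v) ∨ has es (toℕ v) (toℕ u))
  ; adjSym = λ u v → cong₂ _∧_ (neq-sym u v) (∨-comm (has es (toℕ u) (toℕ v)) (has es (toℕ v) (toℕ u)))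
  ; irrefl = λ u → cong₂ _∧_ (neq-refl u) refl
  }

C₃ : Graph
C₃ = mkGraph 3 ((0 , 1) ∷ (1 , 2) ∷ (2 , 0) ∷ [])

C₅ : Graph
C₅ = mkGraph 5 ((0 , 1) ∷ (1 , 2) ∷ (2 , 3) ∷ (3 , 4) ∷ (4 , 0) ∷ [])

P₄ : Graph
P₄ = mkGraph 5 ((0 , 1) ∷ (1 , 2) ∷ (2 , 3) ∷ (3 , 4) ∷ [])

A : Graph
A = mkGraph 6 ((0 , 1) ∷ (1 , 2) ∷ (1 , 4) ∷ (2 , 3) ∷ (3 , 4) ∷ (4 , 5) ∷ [])

-- Edge-colourings of the complete graph on Fin m (colours in ℕ);
-- only the values on distinct pairs matter.
Coloring : ℕ → Set
Coloring m = Fin m → Fin m → ℕ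

ExactGallai : (m : ℕ) → Coloring m → Set
ExactGallai m c =
  (∀ x y → ¬ x ≡ y → c x y ≡ c y x) ×
  (∀ x y z → ¬ x ≡ y → ¬ y ≡ z → ¬ x ≡ z →
     ¬ (c x y ≡ c y z × c y z ≡ c x z) ×
     ¬ (¬ c x y ≡ c y z × ¬ c y z ≡ c x z × ¬ c x y ≡ c x z))

data MonoWalk {m : ℕ} (c : Coloring m) (k : ℕ) : Fin m → Fin m → Set where
  here : ∀ {x} → MonoWalk c k x x
  step : ∀ {x y z} → ¬ x ≡ y → c x y ≡ k → MonoWalk c k y z → MonoWalk c k x z

-- G is (isomorphic to) a monochrome of some exact Gallai clique:
-- there are an exact Gallai clique (m, c), a colour k, a vertex x₀, and an
-- injection f : V(G) → Fin m whose image is exactly the colour-k component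
-- of x₀ and which identifies adjacency of G with colour-k edges.
IsMonochrome : Graph → Set
IsMonochrome G =
  ∃[ m ] Σ (Coloring m) λ c → ExactGallai m c × (∃[ k ] ∃[ x₀ ]
    Σ (Fin (n G) → Fin m) λ f →
      Injective _≡_ _≡_ f ×
      (∀ y → MonoWalk c k x₀ y → ∃[ v ] f v ≡ y) ×
      (∀ v → MonoWalk c k x₀ (f v)) ×
      (∀ u v → (Edge G u v → (¬ f u ≡ f v × c (f u) (f v) ≡ k)) ×
               ((¬ f u ≡ f v × c (f u) (f v) ≡ k) → Edge G u v)))

-- A vertex missing both ends of an edge of one colour class of an exact Gallai
-- clique sees that edge in a single colour, since otherwise the triangle would be
-- rainbow. A full homomorphism from a point-determining graph into a monochrome is
-- an induced copy in such a colour class, and in C₃, P₄ and A chaining this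
-- observation forces a monochromatic triangle.
--
-- Given a full homomorphism g : G → C₅, colour the pair uw of vertices of G by 0
-- if g u g w is an edge of C₅, by 1 if it is a non-edge with g u ≠ g w, and by
-- 2 + min(u, w) if g u = g w. Since C₅ has no triangle and no independent triple,
-- this is an exact Gallai clique, and G is its monochrome of colour 0.
--
-- Conversely, let G be connected and {C₃, P₄, A}-free, and fix an edge xy. Since G
-- is triangle-free, every vertex lies in N(x), in N(y) or is far (adjacent to
-- neither). Excluding induced P₄ and A, and using connectivity, the far vertices
-- form an independent set; a neighbour of y that misses some neighbour of x or
-- sees some far vertex is complete to the far vertices; and two such "loose"
-- neighbours of x and of y are non-adjacent. The tight neighbours of y, tight
-- neighbours of x, loose neighbours of y, far vertices and loose neighbours of x
-- are then the fibres of a full homomorphism onto C₅.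

module Submission where

open import Defs
open import Data.Product using (_×_)
open import Relation.Nullary using (¬_)
open import Function.Bundles using (_⇔_)

open import Data.Bool as Bool using (Bool; true; false)
open import Data.Bool.Properties using (¬-not)
open import Data.Fin as Fin using (Fin; zero; suc; toℕ; #_; _<_; _≟_)
open import Data.Fin.Properties using (all?; any?; <-cmp; toℕ-injective)
open import Data.List using (List; []; map; _++_; allFin)
open import Data.List.Membership.Propositional using (_∈_)
open import Data.List.Membership.Propositional.Properties using (∈-++⁺ˡ; ∈-++⁺ʳ; ∈-map⁺; ∈-allFin)
open import Data.List.Relation.Unary.All as All using (All; _∷_; [])
open import Data.Nat as ℕ using (ℕ; _⊓_; s≤s)
open import Data.Nat.Properties using (suc-injective; ⊓-sel; ⊓-comm; m⊓n≡m⇒m≤n; m⊓n≡n⇒n≤m; ≤-antisym; ≤-trans)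
open import Data.Product as Product using (Σ; ∃-syntax; _,_; proj₁; proj₂)
open import Data.Sum using (_⊎_; inj₁; inj₂)
open import Data.Vec using (Vec; lookup; _∷_; [])
open import Function using (_∘_)
open import Function.Bundles using (mk⇔)
open import Function.Definitions using (Injective)
open import Relation.Binary.Definitions using (tri<; tri≈; tri>)
open import Relation.Binary.PropositionalEquality using (_≡_; refl; sym; trans; cong; cong₂; module ≡-Reasoning)
open import Relation.Nullary using (Dec; yes; no; contradiction)
open import Relation.Nullary.Decidable using (True; toWitness; decidable-stable; ¬?; _×-dec_; _⊎-dec_; _→-dec_)

-- Induced subgraphs

edge-sym : ∀ {G u v} → Edge G u v → Edge G v u
edge-sym {G} {u} {v} uv = trans (adjSym G v u) uv

edge⇒distinct : ∀ {G u v} → Edge G u v → ¬ u ≡ v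
edge⇒distinct {G} {u} e refl = contradiction (trans (sym e) (irrefl G u)) λ ()

nonNeighbour-distinct : ∀ {G u v w} → Edge G u v → adj G w v ≡ false → ¬ w ≡ u
nonNeighbour-distinct uv wv refl = contradiction (trans (sym uv) wv) λ ()

-- Lexicographic: (0,1), (0,2), …, (0,k-1), (1,2), …; an InducedBy table lists
-- adjacencies in this order.
increasingPairs : (k : ℕ) → List (Fin k × Fin k)
increasingPairs ℕ.zero    = []
increasingPairs (ℕ.suc k) =
  map (λ j → zero , suc j) (allFin k) ++ map (Product.map suc suc) (increasingPairs k)

∈-increasingPairs : ∀ {k} {i j : Fin k} → i < j → (i , j) ∈ increasingPairs k
∈-increasingPairs {i = zero}  {suc j} _ = ∈-++⁺ˡ (∈-map⁺ (λ j → zero , suc j) (∈-allFin j))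
∈-increasingPairs {ℕ.suc k} {suc i} {suc j} (s≤s i<j) =
  ∈-++⁺ʳ (map _ (allFin k)) (∈-map⁺ (Product.map suc suc) (∈-increasingPairs i<j))

ReflectsAdjacency : (H G : Graph) → (Fin (n H) → Fin (n G)) → Fin (n H) × Fin (n H) → Set
ReflectsAdjacency H G f (i , j) = adj G (f i) (f j) ≡ adj H i j

fullHom-fromIncreasingPairs : ∀ H G f → All (ReflectsAdjacency H G f) (increasingPairs (n H)) → FullHom H G f
fullHom-fromIncreasingPairs H G f reflects u v with <-cmp u v
... | tri< u<v _ _ = sym (All.lookup reflects (∈-increasingPairs u<v))
... | tri≈ _ refl _ = trans (irrefl H u) (sym (irrefl G (f u)))
... | tri> _ _ v<u = begin
  adj H u v         ≡⟨ adjSym H u v ⟩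
  adj H v u         ≡⟨ All.lookup reflects (∈-increasingPairs v<u) ⟨
  adj G (f v) (f u) ≡⟨ adjSym G (f v) (f u) ⟩
  adj G (f u) (f v) ∎
  where open ≡-Reasoning

InducedBy : (H G : Graph) → Vec (Fin (n G)) (n H) → Set
InducedBy H G vs = All (ReflectsAdjacency H G (lookup vs)) (increasingPairs (n H))

inducedBy⇒hasFullHom : ∀ H G vs → InducedBy H G vs → HasFullHom H G
inducedBy⇒hasFullHom H G vs induced = lookup vs , fullHom-fromIncreasingPairs H G (lookup vs) induced

PointDetermining : Graph → Set
PointDetermining H = ∀ i j → (∀ z → adj H i z ≡ adj H j z) → i ≡ j

fullHom-injective : ∀ {H G h} → PointDetermining H → FullHom H G h → Injective _≡_ _≡_ h
fullHom-injective {H} {G} {h} determining hom {i} {j} hi≡hj = determining i j λ z → begin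
  adj H i z         ≡⟨ hom i z ⟩
  adj G (h i) (h z) ≡⟨ cong (λ v → adj G v (h z)) hi≡hj ⟩
  adj G (h j) (h z) ≡⟨ hom j z ⟨
  adj H j z         ∎
  where open ≡-Reasoning

separated? : (H : Graph) → Dec (∀ i j → ¬ i ≡ j → ∃[ z ] ¬ adj H i z ≡ adj H j z)
separated? H = all? λ i → all? λ j → ¬? (i ≟ j) →-dec any? λ z → ¬? (adj H i z Bool.≟ adj H j z)

pointDetermining-bySeparation : ∀ H → True (separated? H) → PointDetermining H
pointDetermining-bySeparation H separated i j sameNeighbours with i ≟ j
... | yes i≡j = i≡j
... | no i≢j  = let z , differ = toWitness separated i j i≢j in contradiction (sameNeighbours z) differ

pointDetermining-C₃ : PointDetermining C₃
pointDetermining-C₃ = pointDetermining-bySeparation C₃ _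

pointDetermining-P₄ : PointDetermining P₄
pointDetermining-P₄ = pointDetermining-bySeparation P₄ _

pointDetermining-A : PointDetermining A
pointDetermining-A = pointDetermining-bySeparation A _

-- Monochromes of exact Gallai cliques

TwoValued : ℕ → ℕ → ℕ → Set
TwoValued p q r = ¬ (p ≡ q × q ≡ r) × ¬ (¬ p ≡ q × ¬ q ≡ r × ¬ p ≡ r)

record InducedColourCopy {m} (c : Coloring m) (k : ℕ) (H : Graph) : Set where
  field
    embed           : Fin (n H) → Fin m
    embed-injective : Injective _≡_ _≡_ embed
    edge⇒colour     : ∀ {i j} → Edge H i j → c (embed i) (embed j) ≡ k
    nonEdge⇒¬colour : ∀ {i j} → ¬ i ≡ j → adj H i j ≡ false → ¬ c (embed i) (embed j) ≡ k

module InducedColourCopyOfExactGallai {m} {c : Coloring m} (gallai : ExactGallai m c)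
                                      {k H} (copy : InducedColourCopy c k H) where
  open InducedColourCopy copy

  colour : Fin (n H) → Fin (n H) → ℕ
  colour i j = c (embed i) (embed j)

  colour-twoValued : ∀ {i j l} → ¬ i ≡ j → ¬ j ≡ l → ¬ i ≡ l →
    TwoValued (colour i j) (colour j l) (colour i l)
  colour-twoValued i≢j j≢l i≢l =
    proj₂ gallai _ _ _ (i≢j ∘ embed-injective) (j≢l ∘ embed-injective) (i≢l ∘ embed-injective)

  colour-sym : ∀ {i j} → ¬ i ≡ j → colour i j ≡ colour j i
  colour-sym i≢j = proj₁ gallai _ _ (i≢j ∘ embed-injective)

  -- The triangle l i j has exactly one colour-k edge, so it would be rainbow
  -- if its two other edges had distinct colours.
  nonNeighbour-seesEdgeInOneColour : ∀ l i j → Edge H i j → adj H l i ≡ false → adj H l j ≡ false →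
    colour l i ≡ colour l j
  nonNeighbour-seesEdgeInOneColour l i j ij li lj =
    decidable-stable (colour l i ℕ.≟ colour l j) λ li≢lj →
      proj₂ (colour-twoValued l≢i i≢j l≢j)
        ( (λ li≡ij → nonEdge⇒¬colour l≢i li (trans li≡ij (edge⇒colour ij)))
        , (λ ij≡lj → nonEdge⇒¬colour l≢j lj (trans (sym ij≡lj) (edge⇒colour ij)))
        , li≢lj )
    where
    l≢i = nonNeighbour-distinct {H} ij lj
    i≢j = edge⇒distinct {H} ij
    l≢j = nonNeighbour-distinct {H} (edge-sym {H} ij) li

  notMonochromatic : ∀ i j l → ¬ i ≡ j → ¬ j ≡ l → ¬ i ≡ l →
    colour i j ≡ colour j l → ¬ colour j l ≡ colour i l
  notMonochromatic _ _ _ i≢j j≢l i≢l ij≡jl jl≡il = proj₁ (colour-twoValued i≢j j≢l i≢l) (ij≡jl , jl≡il)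

module _ {m} {c : Coloring m} (gallai : ExactGallai m c) {k : ℕ} where
  open ≡-Reasoning

  exactGallai-noInducedCopy-C₃ : ¬ InducedColourCopy c k C₃
  exactGallai-noInducedCopy-C₃ copy =
    notMonochromatic (# 0) (# 1) (# 2) (λ ()) (λ ()) (λ ()) (trans k₀₁ (sym k₁₂)) (trans k₁₂ (sym k₀₂))
    where
    open InducedColourCopy copy
    open InducedColourCopyOfExactGallai gallai copy
    k₀₁ : colour (# 0) (# 1) ≡ k
    k₀₁ = edge⇒colour refl
    k₁₂ : colour (# 1) (# 2) ≡ k
    k₁₂ = edge⇒colour refl
    k₀₂ : colour (# 0) (# 2) ≡ k
    k₀₂ = edge⇒colour refl

  exactGallai-noInducedCopy-P₄ : ¬ InducedColourCopy c k P₄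
  exactGallai-noInducedCopy-P₄ copy =
    notMonochromatic (# 0) (# 2) (# 4) (λ ()) (λ ()) (λ ()) (trans c₀₂≡c₀₄ (sym c₂₄≡c₀₄)) c₂₄≡c₀₄
    where
    open InducedColourCopyOfExactGallai gallai copy
    c₀₂≡c₀₄ : colour (# 0) (# 2) ≡ colour (# 0) (# 4)
    c₀₂≡c₀₄ = begin
      colour (# 0) (# 2) ≡⟨ nonNeighbour-seesEdgeInOneColour (# 0) (# 2) (# 3) refl refl refl ⟩
      colour (# 0) (# 3) ≡⟨ nonNeighbour-seesEdgeInOneColour (# 0) (# 3) (# 4) refl refl refl ⟩
      colour (# 0) (# 4) ∎
    c₂₄≡c₀₄ : colour (# 2) (# 4) ≡ colour (# 0) (# 4)
    c₂₄≡c₀₄ = begin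
      colour (# 2) (# 4) ≡⟨ colour-sym (λ ()) ⟩
      colour (# 4) (# 2) ≡⟨ nonNeighbour-seesEdgeInOneColour (# 4) (# 2) (# 1) refl refl refl ⟩
      colour (# 4) (# 1) ≡⟨ nonNeighbour-seesEdgeInOneColour (# 4) (# 1) (# 0) refl refl refl ⟩
      colour (# 4) (# 0) ≡⟨ colour-sym (λ ()) ⟩
      colour (# 0) (# 4) ∎

  exactGallai-noInducedCopy-A : ¬ InducedColourCopy c k A
  exactGallai-noInducedCopy-A copy =
    notMonochromatic (# 0) (# 2) (# 4) (λ ()) (λ ()) (λ ()) (trans c₀₂≡c₀₄ (sym c₂₄≡c₀₄)) c₂₄≡c₀₄
    where
    open InducedColourCopyOfExactGallai gallai copy
    c₀₂≡c₀₄ : colour (# 0) (# 2) ≡ colour (# 0) (# 4)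
    c₀₂≡c₀₄ = begin
      colour (# 0) (# 2) ≡⟨ nonNeighbour-seesEdgeInOneColour (# 0) (# 2) (# 3) refl refl refl ⟩
      colour (# 0) (# 3) ≡⟨ nonNeighbour-seesEdgeInOneColour (# 0) (# 3) (# 4) refl refl refl ⟩
      colour (# 0) (# 4) ∎
    c₂₄≡c₀₄ : colour (# 2) (# 4) ≡ colour (# 0) (# 4)
    c₂₄≡c₀₄ = begin
      colour (# 2) (# 4) ≡⟨ nonNeighbour-seesEdgeInOneColour (# 2) (# 4) (# 5) refl refl refl ⟩
      colour (# 2) (# 5) ≡⟨ colour-sym (λ ()) ⟩
      colour (# 5) (# 2) ≡⟨ nonNeighbour-seesEdgeInOneColour (# 5) (# 2) (# 1) refl refl refl ⟩
      colour (# 5) (# 1) ≡⟨ nonNeighbour-seesEdgeInOneColour (# 5) (# 1) (# 0) refl refl refl ⟩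
      colour (# 5) (# 0) ≡⟨ colour-sym (λ ()) ⟩
      colour (# 0) (# 5) ≡⟨ nonNeighbour-seesEdgeInOneColour (# 0) (# 5) (# 4) refl refl refl ⟩
      colour (# 0) (# 4) ∎

ForbiddenFree : Graph → Set
ForbiddenFree G = ¬ HasFullHom C₃ G × ¬ HasFullHom P₄ G × ¬ HasFullHom A G

monochrome-excludes : ∀ G {H} → PointDetermining H →
  (∀ {m} {c : Coloring m} → ExactGallai m c → ∀ {k} → ¬ InducedColourCopy c k H) →
  IsMonochrome G → ¬ HasFullHom H G
monochrome-excludes G {H} determining noCopy (_ , c , gallai , k , _ , f , f-injective , _ , _ , edge⇔) (h , hom) =
  noCopy gallai copy
  where
  embed-injective : Injective _≡_ _≡_ (f ∘ h)
  embed-injective = fullHom-injective {H} {G} determining hom ∘ f-injective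

  copy : InducedColourCopy c k H
  copy = record
    { embed           = f ∘ h
    ; embed-injective = embed-injective
    ; edge⇒colour     = λ {i} {j} ij → proj₂ (proj₁ (edge⇔ (h i) (h j)) (trans (sym (hom i j)) ij))
    ; nonEdge⇒¬colour = λ {i} {j} i≢j ij coloured →
        contradiction (trans (sym ij) (trans (hom i j)
          (proj₂ (edge⇔ (h i) (h j)) (i≢j ∘ embed-injective , coloured)))) λ ()
    }

monochrome⇒forbiddenFree : ∀ G → IsMonochrome G → ForbiddenFree G
monochrome⇒forbiddenFree G mono =
  monochrome-excludes G pointDetermining-C₃ exactGallai-noInducedCopy-C₃ mono ,
  monochrome-excludes G pointDetermining-P₄ exactGallai-noInducedCopy-P₄ mono ,
  monochrome-excludes G pointDetermining-A exactGallai-noInducedCopy-A mono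

-- Blowing up a graph into an exact Gallai clique

twoValued-suc : ∀ {p q r} → TwoValued p q r → TwoValued (ℕ.suc p) (ℕ.suc q) (ℕ.suc r)
twoValued-suc (notAllEqual , notAllDistinct) =
  (λ (pq , qr) → notAllEqual (suc-injective pq , suc-injective qr)) ,
  (λ (p≢q , q≢r , p≢r) → notAllDistinct (p≢q ∘ cong ℕ.suc , q≢r ∘ cong ℕ.suc , p≢r ∘ cong ℕ.suc))

twoValued-⊓ : ∀ {a b c} → ¬ a ≡ b → ¬ b ≡ c → ¬ a ≡ c → TwoValued (a ⊓ b) (b ⊓ c) (a ⊓ c)
twoValued-⊓ {a} {b} {c} a≢b b≢c a≢c = notAllEqual , notAllDistinct
  where
  notAllEqual : ¬ (a ⊓ b ≡ b ⊓ c × b ⊓ c ≡ a ⊓ c)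
  notAllEqual (ab≡bc , bc≡ac) with ⊓-sel a b | ⊓-sel b c | ⊓-sel a c
  ... | inj₁ ab≡a | inj₁ bc≡b | _         = a≢b (trans (sym ab≡a) (trans ab≡bc bc≡b))
  ... | inj₁ ab≡a | inj₂ bc≡c | _         = a≢c (trans (sym ab≡a) (trans ab≡bc bc≡c))
  ... | inj₂ ab≡b | _         | inj₁ ac≡a = a≢b (trans (sym ac≡a) (trans (sym bc≡ac) (trans (sym ab≡bc) ab≡b)))
  ... | inj₂ ab≡b | _         | inj₂ ac≡c = b≢c (trans (sym ab≡b) (trans ab≡bc (trans bc≡ac ac≡c)))
  notAllDistinct : ¬ (¬ a ⊓ b ≡ b ⊓ c × ¬ b ⊓ c ≡ a ⊓ c × ¬ a ⊓ b ≡ a ⊓ c)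
  notAllDistinct (d₁ , d₂ , d₃) with ⊓-sel a b | ⊓-sel b c | ⊓-sel a c
  ... | inj₁ ab≡a | _         | inj₁ ac≡a = d₃ (trans ab≡a (sym ac≡a))
  ... | inj₁ ab≡a | inj₁ bc≡b | inj₂ ac≡c =
    a≢c (≤-antisym (≤-trans (m⊓n≡m⇒m≤n ab≡a) (m⊓n≡m⇒m≤n bc≡b)) (m⊓n≡n⇒n≤m ac≡c))
  ... | inj₁ _    | inj₂ bc≡c | inj₂ ac≡c = d₂ (trans bc≡c (sym ac≡c))
  ... | inj₂ ab≡b | inj₁ bc≡b | _         = d₁ (trans ab≡b (sym bc≡b))
  ... | inj₂ ab≡b | inj₂ bc≡c | inj₁ ac≡a =
    a≢b (≤-antisym (≤-trans (m⊓n≡m⇒m≤n ac≡a) (m⊓n≡n⇒n≤m bc≡c)) (m⊓n≡n⇒n≤m ab≡b))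
  ... | inj₂ _    | inj₂ bc≡c | inj₂ ac≡c = d₂ (trans bc≡c (sym ac≡c))

twoValued-oddFirst : ∀ {p q} → ¬ p ≡ q → TwoValued p q q
twoValued-oddFirst p≢q = (λ (pq , _) → p≢q pq) , (λ (_ , q≢q , _) → q≢q refl)

twoValued-oddSecond : ∀ {p q} → ¬ p ≡ q → TwoValued q p q
twoValued-oddSecond p≢q = (λ (qp , _) → p≢q (sym qp)) , (λ (_ , _ , q≢q) → q≢q refl)

twoValued-oddThird : ∀ {p q} → ¬ p ≡ q → TwoValued q q p
twoValued-oddThird p≢q = (λ (_ , qp) → p≢q (sym qp)) , (λ (q≢q , _ , _) → q≢q refl)

bit : Bool → ℕ
bit true  = 0
bit false = 1

bit-injective : ∀ {a b} → bit a ≡ bit b → a ≡ b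
bit-injective {true}  {true}  _ = refl
bit-injective {false} {false} _ = refl

bit≢2+ : ∀ a m → ¬ bit a ≡ 2 ℕ.+ m
bit≢2+ true  _ ()
bit≢2+ false _ ()

bits-notAllDistinct : ∀ a b c → ¬ (¬ bit a ≡ bit b × ¬ bit b ≡ bit c × ¬ bit a ≡ bit c)
bits-notAllDistinct true  true  _     (ab , _)      = ab refl
bits-notAllDistinct false false _     (ab , _)      = ab refl
bits-notAllDistinct true  false true  (_ , _ , ac)  = ac refl
bits-notAllDistinct true  false false (_ , bc , _)  = bc refl
bits-notAllDistinct false true  true  (_ , bc , _)  = bc refl
bits-notAllDistinct false true  false (_ , _ , ac)  = ac refl

twoValued-bit : ∀ a b c → ¬ (a ≡ b × b ≡ c) → TwoValued (bit a) (bit b) (bit c)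
twoValued-bit a b c notAllEqual =
  (λ (ab , bc) → notAllEqual (bit-injective ab , bit-injective bc)) , bits-notAllDistinct a b c

NoHomogeneousTriple : Graph → Set
NoHomogeneousTriple H = ∀ a b c → ¬ a ≡ b → ¬ b ≡ c → ¬ a ≡ c →
  ¬ (adj H a b ≡ adj H b c × adj H b c ≡ adj H a c)

noHomogeneousTriple? : ∀ H → Dec (NoHomogeneousTriple H)
noHomogeneousTriple? H = all? λ a → all? λ b → all? λ c →
  ¬? (a ≟ b) →-dec ¬? (b ≟ c) →-dec ¬? (a ≟ c) →-dec
  ¬? ((adj H a b Bool.≟ adj H b c) ×-dec (adj H b c Bool.≟ adj H a c))

noHomogeneousTriple-C₅ : NoHomogeneousTriple C₅
noHomogeneousTriple-C₅ = toWitness {a? = noHomogeneousTriple? C₅} _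

-- Colour 0 on edges and 1 on non-edges between distinct fibres of g; inside a
-- fibre the edge uw gets colour 2 + min(u, w), the standard exact Gallai
-- colouring of a clique.
module BlowUp (H : Graph) {N} (g : Fin N → Fin (n H)) where
  colouring : Coloring N
  colouring u w with g u ≟ g w
  ... | yes _ = 2 ℕ.+ (toℕ u ⊓ toℕ w)
  ... | no _  = bit (adj H (g u) (g w))

  colouring-sym : ∀ u w → colouring u w ≡ colouring w u
  colouring-sym u w with g u ≟ g w | g w ≟ g u
  ... | yes _  | yes _  = cong (2 ℕ.+_) (⊓-comm (toℕ u) (toℕ w))
  ... | no _   | no _   = cong bit (adjSym H (g u) (g w))
  ... | yes uw | no wu  = contradiction (sym uw) wu
  ... | no uw  | yes wu = contradiction (sym wu) uw

  colouring-twoValued : NoHomogeneousTriple H → ∀ {x y z} → ¬ x ≡ y → ¬ y ≡ z → ¬ x ≡ z →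
    TwoValued (colouring x y) (colouring y z) (colouring x z)
  colouring-twoValued noHomogeneous {x} {y} {z} x≢y y≢z x≢z with g x ≟ g y | g y ≟ g z | g x ≟ g z
  ... | yes _  | yes _  | yes _  = twoValued-suc (twoValued-suc (twoValued-⊓
    (x≢y ∘ toℕ-injective) (y≢z ∘ toℕ-injective) (x≢z ∘ toℕ-injective)))
  ... | yes xy | yes yz | no xz  = contradiction (trans xy yz) xz
  ... | yes xy | no yz  | yes xz = contradiction (trans (sym xy) xz) yz
  ... | no xy  | yes yz | yes xz = contradiction (trans xz (sym yz)) xy
  ... | yes xy | no _   | no _   rewrite xy = twoValued-oddFirst (bit≢2+ _ _ ∘ sym)
  ... | no _   | yes yz | no _   rewrite yz = twoValued-oddSecond (bit≢2+ _ _ ∘ sym)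
  ... | no _   | no _   | yes xz rewrite xz | adjSym H (g z) (g y) = twoValued-oddThird (bit≢2+ _ _ ∘ sym)
  ... | no xy  | no yz  | no xz  =
    twoValued-bit _ _ _ (noHomogeneous (g x) (g y) (g z) xy yz xz)

  colouring≡0⇒edge : ∀ u w → colouring u w ≡ 0 → Edge H (g u) (g w)
  colouring≡0⇒edge u w with g u ≟ g w
  ... | yes _ = λ ()
  ... | no _  = bit-injective

  edge⇒colouring≡0 : ∀ u w → Edge H (g u) (g w) → colouring u w ≡ 0
  edge⇒colouring≡0 u w uw with g u ≟ g w
  ... | yes same = contradiction same (edge⇒distinct {H} uw)
  ... | no _     = cong bit uw

fullHom⇒monochrome : ∀ G H → NoHomogeneousTriple H → Connected G → HasFullHom G H → IsMonochrome G
fullHom⇒monochrome G H noHomogeneous (nonEmpty , walk) (g , hom) =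
  n G , colouring , exactGallai , 0 , x₀ , (λ v → v) , (λ same → same) , (λ y _ → y , refl) ,
  (λ v → monoWalk (walk x₀ v)) ,
  λ u v → (λ uv → edge⇒distinct {G} uv , edge⇒coloured0 uv) ,
          (λ (_ , coloured) → trans (hom u v) (colouring≡0⇒edge u v coloured))
  where
  open BlowUp H g

  exactGallai : ExactGallai (n G) colouring
  exactGallai = (λ u w _ → colouring-sym u w) , λ _ _ _ → colouring-twoValued noHomogeneous

  x₀ : Fin (n G)
  x₀ = Fin.fromℕ< nonEmpty

  edge⇒coloured0 : ∀ {u v} → Edge G u v → colouring u v ≡ 0
  edge⇒coloured0 {u} {v} uv = edge⇒colouring≡0 u v (trans (sym (hom u v)) uv)

  monoWalk : ∀ {u v} → Walk G u v → MonoWalk colouring 0 u v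
  monoWalk here         = here
  monoWalk (step uw wv) = step (edge⇒distinct {G} uw) (edge⇒coloured0 uw) (monoWalk wv)

-- Connected {C₃, P₄, A}-free graphs

module ForbiddenFreeConnected (G : Graph) (connected : Connected G) (free : ForbiddenFree G) where
  V : Set
  V = Fin (n G)

  _~_ : V → V → Set
  u ~ v = adj G u v ≡ true

  _≁_ : V → V → Set
  u ≁ v = adj G u v ≡ false

  sym-adj : ∀ {u v b} → adj G u v ≡ b → adj G v u ≡ b
  sym-adj {u} {v} uv = trans (adjSym G v u) uv

  ~⇒¬≁ : ∀ {u v} → u ~ v → ¬ u ≁ v
  ~⇒¬≁ uv u≁v = contradiction (trans (sym uv) u≁v) λ ()

  adjacent-byContradiction : ∀ {u v} → ¬ u ≁ v → u ~ v
  adjacent-byContradiction = ¬-not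

  nonadjacent-byContradiction : ∀ {u v} → ¬ u ~ v → u ≁ v
  nonadjacent-byContradiction = ¬-not

  noInduced-C₃ : ∀ vs → ¬ InducedBy C₃ G vs
  noInduced-C₃ vs = proj₁ free ∘ inducedBy⇒hasFullHom C₃ G vs

  noInduced-P₄ : ∀ vs → ¬ InducedBy P₄ G vs
  noInduced-P₄ vs = proj₁ (proj₂ free) ∘ inducedBy⇒hasFullHom P₄ G vs

  noInduced-A : ∀ vs → ¬ InducedBy A G vs
  noInduced-A vs = proj₂ (proj₂ free) ∘ inducedBy⇒hasFullHom A G vs

  triangleFree : ∀ {a b c} → a ~ b → b ~ c → a ≁ c
  triangleFree {a} {b} {c} ab bc =
    nonadjacent-byContradiction λ ac → noInduced-C₃ (a ∷ b ∷ c ∷ []) (ab ∷ ac ∷ bc ∷ [])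

  Far : V → V → V → Set
  Far x y r = r ≁ x × r ≁ y

  Loose : V → V → V → Set
  Loose x y u = (Σ V λ w → w ~ x × u ≁ w) ⊎ (Σ V λ r → Far x y r × u ~ r)

  Tight : V → V → V → Set
  Tight x y u = (∀ w → w ~ x → u ~ w) × (∀ r → Far x y r → u ≁ r)

  loose? : ∀ x y u → Dec (Loose x y u)
  loose? x y u =
    any? (λ w → (adj G w x Bool.≟ true) ×-dec (adj G u w Bool.≟ false)) ⊎-dec
    any? (λ r → ((adj G r x Bool.≟ false) ×-dec (adj G r y Bool.≟ false)) ×-dec (adj G u r Bool.≟ true))

  ¬loose⇒tight : ∀ {x y u} → ¬ Loose x y u → Tight x y u
  ¬loose⇒tight notLoose =
    (λ w wx → adjacent-byContradiction λ uw → notLoose (inj₁ (w , wx , uw))) ,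
    (λ r far-r → nonadjacent-byContradiction λ ur → notLoose (inj₂ (r , far-r , ur)))

  module AroundEdge (x y : V) (x~y : x ~ y) where
    y~x : y ~ x
    y~x = sym-adj x~y

    ~y⇒≁x : ∀ {u} → u ~ y → u ≁ x
    ~y⇒≁x uy = triangleFree uy y~x

    ~x⇒≁y : ∀ {u} → u ~ x → u ≁ y
    ~x⇒≁y ux = triangleFree ux x~y

    Near : V → Set
    Near m = m ~ y ⊎ m ~ x

    far-shortcut : ∀ {r w m} → Far x y r → Far x y w → r ~ w → w ~ m → Near m → r ~ m
    far-shortcut {r} {w} {m} (rx , ry) (wx , wy) rw wm near = adjacent-byContradiction (noPath near)
      where
      noPath : Near m → ¬ r ≁ m
      noPath (inj₁ my) rm = noInduced-P₄ (x ∷ y ∷ m ∷ w ∷ r ∷ [])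
        (x~y ∷ sym-adj (~y⇒≁x my) ∷ sym-adj wx ∷ sym-adj rx ∷ sym-adj my ∷ sym-adj wy ∷ sym-adj ry ∷
         sym-adj wm ∷ sym-adj rm ∷ sym-adj rw ∷ [])
      noPath (inj₂ mx) rm = noInduced-P₄ (y ∷ x ∷ m ∷ w ∷ r ∷ [])
        (y~x ∷ sym-adj (~x⇒≁y mx) ∷ sym-adj wy ∷ sym-adj ry ∷ sym-adj mx ∷ sym-adj wx ∷ sym-adj rx ∷
         sym-adj wm ∷ sym-adj rm ∷ sym-adj rw ∷ [])

    far-hasNearNeighbour : ∀ {r} → Far x y r → Σ V λ m → r ~ m × Near m
    far-hasNearNeighbour {r} far-r = alongWalk far-r (proj₂ connected r x)
      where
      alongWalk : ∀ {r} → Far x y r → Walk G r x → Σ V λ m → r ~ m × Near m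
      alongWalk (_ , xy) here = contradiction (trans (sym x~y) xy) λ ()
      alongWalk far-r (step {v = w} rw walk) with adj G w y in wy | adj G w x in wx
      ... | true  | _     = w , rw , inj₁ wy
      ... | false | true  = w , rw , inj₂ wx
      ... | false | false =
        let m , wm , near = alongWalk (wx , wy) walk in m , far-shortcut far-r (wx , wy) rw wm near , near

    far-independent : ∀ {r r'} → Far x y r → Far x y r' → r ≁ r'
    far-independent far-r far-r' = nonadjacent-byContradiction λ rr' →
      let m , r'm , near = far-hasNearNeighbour far-r' in
      ~⇒¬≁ (far-shortcut far-r far-r' rr' r'm near) (triangleFree rr' r'm)

    noInducedPath-far-x-y : ∀ {r m u} → Far x y r → u ~ y → u ≁ r → r ~ m → m ~ x → ¬ m ≁ u
    noInducedPath-far-x-y {r} {m} {u} (rx , ry) uy ur rm mx mu = noInduced-P₄ (r ∷ m ∷ x ∷ y ∷ u ∷ [])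
      (rm ∷ rx ∷ ry ∷ sym-adj ur ∷ mx ∷ ~x⇒≁y mx ∷ mu ∷ x~y ∷ sym-adj (~y⇒≁x uy) ∷ sym-adj uy ∷ [])

    missing⇒completeToFar : ∀ {u w r} → u ~ y → w ~ x → u ≁ w → Far x y r → ¬ u ≁ r
    missing⇒completeToFar {u} {w} {r} uy wx uw far-r@(rx , ry) ur
      with adj G w r in wr | far-hasNearNeighbour far-r
    ... | true  | _ = noInduced-P₄ (u ∷ y ∷ x ∷ w ∷ r ∷ [])
      (uy ∷ ~y⇒≁x uy ∷ uw ∷ ur ∷ y~x ∷ sym-adj (~x⇒≁y wx) ∷ sym-adj ry ∷ sym-adj wx ∷ sym-adj rx ∷ wr ∷ [])
    ... | false | m , rm , inj₁ my with adj G m w in mw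
    ...   | true  = noInduced-A (r ∷ m ∷ w ∷ x ∷ y ∷ u ∷ [])
      (rm ∷ sym-adj wr ∷ rx ∷ ry ∷ sym-adj ur ∷ mw ∷ ~y⇒≁x my ∷ my ∷ triangleFree my (sym-adj uy) ∷
       wx ∷ ~x⇒≁y wx ∷ sym-adj uw ∷ x~y ∷ sym-adj (~y⇒≁x uy) ∷ sym-adj uy ∷ [])
    ...   | false = noInduced-P₄ (r ∷ m ∷ y ∷ x ∷ w ∷ [])
      (rm ∷ ry ∷ rx ∷ sym-adj wr ∷ my ∷ ~y⇒≁x my ∷ mw ∷ y~x ∷ sym-adj (~x⇒≁y wx) ∷ sym-adj wx ∷ [])
    missing⇒completeToFar {u} {w} {r} uy wx uw far-r@(rx , ry) ur
        | false | m , rm , inj₂ mx with adj G m u in mu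
    ...   | true  = noInduced-A (r ∷ m ∷ u ∷ y ∷ x ∷ w ∷ [])
      (rm ∷ sym-adj ur ∷ ry ∷ rx ∷ sym-adj wr ∷ mu ∷ ~x⇒≁y mx ∷ mx ∷ triangleFree mx (sym-adj wx) ∷
       uy ∷ ~y⇒≁x uy ∷ uw ∷ y~x ∷ sym-adj (~x⇒≁y wx) ∷ sym-adj wx ∷ [])
    ...   | false = noInducedPath-far-x-y far-r uy ur rm mx mu

    farNeighbour⇒completeToFar : ∀ {u r' r} → u ~ y → Far x y r' → u ~ r' → Far x y r → ¬ u ≁ r
    farNeighbour⇒completeToFar {u} {r'} {r} uy far-r'@(r'x , r'y) ur' far-r@(rx , ry) ur
      with far-hasNearNeighbour far-r
    ... | m , rm , inj₁ my with adj G m r' in mr'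
    ...   | true  = noInduced-A (r ∷ m ∷ r' ∷ u ∷ y ∷ x ∷ [])
      (rm ∷ far-independent far-r far-r' ∷ sym-adj ur ∷ ry ∷ rx ∷ mr' ∷ triangleFree my (sym-adj uy) ∷ my ∷
       ~y⇒≁x my ∷ sym-adj ur' ∷ r'y ∷ r'x ∷ uy ∷ ~y⇒≁x uy ∷ y~x ∷ [])
    ...   | false = noInduced-P₄ (r ∷ m ∷ y ∷ u ∷ r' ∷ [])
      (rm ∷ ry ∷ sym-adj ur ∷ far-independent far-r far-r' ∷ my ∷ triangleFree my (sym-adj uy) ∷ mr' ∷
       sym-adj uy ∷ sym-adj r'y ∷ ur' ∷ [])
    farNeighbour⇒completeToFar {u} {r'} {r} uy far-r'@(r'x , r'y) ur' far-r@(rx , ry) ur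
        | m , rm , inj₂ mx with adj G m u in mu
    ...   | true  = noInduced-A (r' ∷ u ∷ y ∷ x ∷ m ∷ r ∷ [])
      (sym-adj ur' ∷ r'y ∷ r'x ∷ triangleFree (sym-adj ur') (sym-adj mu) ∷ far-independent far-r' far-r ∷
       uy ∷ ~y⇒≁x uy ∷ sym-adj mu ∷ ur ∷ y~x ∷ sym-adj (~x⇒≁y mx) ∷ sym-adj ry ∷ sym-adj mx ∷ sym-adj rx ∷
       sym-adj rm ∷ [])
    ...   | false = noInducedPath-far-x-y far-r uy ur rm mx mu

    loose⇒completeToFar : ∀ {u r} → u ~ y → Loose x y u → Far x y r → u ~ r
    loose⇒completeToFar uy (inj₁ (w , wx , uw)) far-r =
      adjacent-byContradiction (missing⇒completeToFar uy wx uw far-r)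
    loose⇒completeToFar uy (inj₂ (r' , far-r' , ur')) far-r =
      adjacent-byContradiction (farNeighbour⇒completeToFar uy far-r' ur' far-r)

    looseNeighbours-nonadjacent : ∀ {u v} → u ~ y → Loose x y u → v ~ x → Loose y x v → u ≁ v
    looseNeighbours-nonadjacent {u} {v} uy loose-u vx loose-v = nonadjacent-byContradiction (noEdge loose-u loose-v)
      where
      noEdge : Loose x y u → Loose y x v → ¬ u ~ v
      noEdge (inj₂ (r' , (r'x , r'y) , ur')) (inj₂ (r'' , (r''y , r''x) , vr'')) uv =
        noInduced-A (r' ∷ u ∷ y ∷ x ∷ v ∷ r'' ∷ [])
          (sym-adj ur' ∷ r'y ∷ r'x ∷ triangleFree (sym-adj ur') uv ∷ far-independent (r'x , r'y) (r''x , r''y) ∷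
           uy ∷ ~y⇒≁x uy ∷ uv ∷ triangleFree uv vr'' ∷ y~x ∷ sym-adj (~x⇒≁y vx) ∷ sym-adj r''y ∷ sym-adj vx ∷
           sym-adj r''x ∷ vr'' ∷ [])
      noEdge (inj₂ (r' , (r'x , r'y) , ur')) (inj₁ (w' , w'y , vw')) uv with adj G w' r' in w'r'
      ... | true  = noInduced-P₄ (w' ∷ r' ∷ u ∷ v ∷ x ∷ [])
        (w'r' ∷ triangleFree w'y (sym-adj uy) ∷ sym-adj vw' ∷ ~y⇒≁x w'y ∷ sym-adj ur' ∷ triangleFree (sym-adj ur') uv ∷
         r'x ∷ uv ∷ ~y⇒≁x uy ∷ vx ∷ [])
      ... | false = noInduced-A (r' ∷ u ∷ v ∷ x ∷ y ∷ w' ∷ [])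
        (sym-adj ur' ∷ triangleFree (sym-adj ur') uv ∷ r'x ∷ r'y ∷ sym-adj w'r' ∷ uv ∷ ~y⇒≁x uy ∷ uy ∷
         triangleFree uy (sym-adj w'y) ∷ vx ∷ ~x⇒≁y vx ∷ vw' ∷ x~y ∷ sym-adj (~y⇒≁x w'y) ∷ sym-adj w'y ∷ [])
      noEdge (inj₁ (w , wx , uw)) (inj₂ (r'' , (r''y , r''x) , vr'')) uv with adj G w r'' in wr''
      ... | true  = noInduced-P₄ (w ∷ r'' ∷ v ∷ u ∷ y ∷ [])
        (wr'' ∷ triangleFree wx (sym-adj vx) ∷ sym-adj uw ∷ ~x⇒≁y wx ∷ sym-adj vr'' ∷
         triangleFree (sym-adj vr'') (sym-adj uv) ∷ r''y ∷ sym-adj uv ∷ ~x⇒≁y vx ∷ uy ∷ [])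
      ... | false = noInduced-A (r'' ∷ v ∷ u ∷ y ∷ x ∷ w ∷ [])
        (sym-adj vr'' ∷ triangleFree (sym-adj vr'') (sym-adj uv) ∷ r''y ∷ r''x ∷ sym-adj wr'' ∷ sym-adj uv ∷
         ~x⇒≁y vx ∷ vx ∷ triangleFree vx (sym-adj wx) ∷ uy ∷ ~y⇒≁x uy ∷ uw ∷ y~x ∷ sym-adj (~x⇒≁y wx) ∷
         sym-adj wx ∷ [])
      noEdge (inj₁ (w , wx , uw)) (inj₁ (w' , w'y , vw')) uv with adj G w' w in w'w
      ... | true  = noInduced-P₄ (w ∷ w' ∷ y ∷ u ∷ v ∷ [])
        (sym-adj w'w ∷ ~x⇒≁y wx ∷ sym-adj uw ∷ triangleFree wx (sym-adj vx) ∷ w'y ∷ triangleFree w'y (sym-adj uy) ∷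
         sym-adj vw' ∷ sym-adj uy ∷ sym-adj (~x⇒≁y vx) ∷ uv ∷ [])
      ... | false = noInduced-A (w' ∷ y ∷ u ∷ v ∷ x ∷ w ∷ [])
        (w'y ∷ triangleFree w'y (sym-adj uy) ∷ sym-adj vw' ∷ ~y⇒≁x w'y ∷ w'w ∷ sym-adj uy ∷ sym-adj (~x⇒≁y vx) ∷
         y~x ∷ sym-adj (~x⇒≁y wx) ∷ uv ∷ ~y⇒≁x uy ∷ uw ∷ vx ∷ triangleFree vx (sym-adj wx) ∷ sym-adj wx ∷ [])

  module FiveClasses (x y : V) (x~y : x ~ y) where
    open AroundEdge x y x~y
    module Mirror = AroundEdge y x y~x

    data Class (v : V) : Fin 5 → Set where
      tight-y : v ~ y → Tight x y v → Class v (# 0)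
      tight-x : v ~ x → Tight y x v → Class v (# 1)
      loose-y : v ~ y → Loose x y v → Class v (# 2)
      far     : Far x y v           → Class v (# 3)
      loose-x : v ~ x → Loose y x v → Class v (# 4)

    classify : ∀ v → Σ (Fin 5) (Class v)
    classify v with adj G v y in vy | adj G v x in vx | loose? x y v | loose? y x v
    ... | true  | _     | yes loose    | _            = # 2 , loose-y vy loose
    ... | true  | _     | no notLoose  | _            = # 0 , tight-y vy (¬loose⇒tight notLoose)
    ... | false | true  | _            | yes loose    = # 4 , loose-x vx loose
    ... | false | true  | _            | no notLoose  = # 1 , tight-x vx (¬loose⇒tight notLoose)
    ... | false | false | _            | _            = # 3 , far (vx , vy)

    toC₅ : V → Fin 5
    toC₅ v = proj₁ (classify v)

    looseX⇒completeToFar : ∀ {v r} → v ~ x → Loose y x v → Far x y r → v ~ r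
    looseX⇒completeToFar vx loose-v far-r = Mirror.loose⇒completeToFar vx loose-v (Product.swap far-r)

    toC₅-fullHom : FullHom G C₅ toC₅
    toC₅-fullHom u v with classify u | classify v
    ... | _ , tight-y uy _           | _ , tight-y vy _           = triangleFree uy (sym-adj vy)
    ... | _ , tight-y _ (seesX , _)  | _ , tight-x vx _           = seesX v vx
    ... | _ , tight-y uy _           | _ , loose-y vy _           = triangleFree uy (sym-adj vy)
    ... | _ , tight-y _ (_ , misses) | _ , far fv                 = misses v fv
    ... | _ , tight-y _ (seesX , _)  | _ , loose-x vx _           = seesX v vx
    ... | _ , tight-x ux _           | _ , tight-y _ (seesX , _)  = sym-adj (seesX u ux)
    ... | _ , tight-x ux _           | _ , tight-x vx _           = triangleFree ux (sym-adj vx)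
    ... | _ , tight-x _ (seesY , _)  | _ , loose-y vy _           = seesY v vy
    ... | _ , tight-x _ (_ , misses) | _ , far fv                 = misses v (Product.swap fv)
    ... | _ , tight-x ux _           | _ , loose-x vx _           = triangleFree ux (sym-adj vx)
    ... | _ , loose-y uy _           | _ , tight-y vy _           = triangleFree uy (sym-adj vy)
    ... | _ , loose-y uy _           | _ , tight-x _ (seesY , _)  = sym-adj (seesY u uy)
    ... | _ , loose-y uy _           | _ , loose-y vy _           = triangleFree uy (sym-adj vy)
    ... | _ , loose-y uy lu          | _ , far fv                 = loose⇒completeToFar uy lu fv
    ... | _ , loose-y uy lu          | _ , loose-x vx lv          = looseNeighbours-nonadjacent uy lu vx lv
    ... | _ , far fu                 | _ , tight-y _ (_ , misses) = sym-adj (misses u fu)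
    ... | _ , far fu                 | _ , tight-x _ (_ , misses) = sym-adj (misses u (Product.swap fu))
    ... | _ , far fu                 | _ , loose-y vy lv          = sym-adj (loose⇒completeToFar vy lv fu)
    ... | _ , far fu                 | _ , far fv                 = far-independent fu fv
    ... | _ , far fu                 | _ , loose-x vx lv          = sym-adj (looseX⇒completeToFar vx lv fu)
    ... | _ , loose-x ux _           | _ , tight-y _ (seesX , _)  = sym-adj (seesX u ux)
    ... | _ , loose-x ux _           | _ , tight-x vx _           = triangleFree ux (sym-adj vx)
    ... | _ , loose-x ux lu          | _ , loose-y vy lv          = sym-adj (looseNeighbours-nonadjacent vy lv ux lu)
    ... | _ , loose-x ux lu          | _ , far fv                 = looseX⇒completeToFar ux lu fv
    ... | _ , loose-x ux _           | _ , loose-x vx _           = triangleFree ux (sym-adj vx)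

  isolated⇒onlyVertex : ∀ {x₀} → ¬ (∃[ w ] x₀ ~ w) → ∀ u → u ≡ x₀
  isolated⇒onlyVertex {x₀} isolated u with proj₂ connected x₀ u
  ... | here             = refl
  ... | step {v = w} x₀w _ = contradiction (w , x₀w) isolated

  x₀ : V
  x₀ = Fin.fromℕ< (proj₁ connected)

  fullHom-C₅ : HasFullHom G C₅
  fullHom-C₅ with any? (λ w → adj G x₀ w Bool.≟ true)
  ... | yes (y , x₀~y) = toC₅ , toC₅-fullHom
    where open FiveClasses x₀ y x₀~y
  ... | no isolated    = (λ _ → # 0) , λ u v → begin
    adj G u v   ≡⟨ cong₂ (adj G) (isolated⇒onlyVertex isolated u) (isolated⇒onlyVertex isolated v) ⟩
    adj G x₀ x₀ ≡⟨ irrefl G x₀ ⟩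
    false       ∎
    where open ≡-Reasoning

mainTheorem19 : (G : Graph) → Connected G →
    ((¬ HasFullHom C₃ G × ¬ HasFullHom P₄ G × ¬ HasFullHom A G) ⇔ HasFullHom G C₅) ×
    (HasFullHom G C₅ ⇔ IsMonochrome G)
mainTheorem19 G connected =
  mk⇔ forbiddenFree⇒C₅ (monochrome⇒forbiddenFree G ∘ C₅⇒monochrome) ,
  mk⇔ C₅⇒monochrome (forbiddenFree⇒C₅ ∘ monochrome⇒forbiddenFree G)
  where
  forbiddenFree⇒C₅ : ForbiddenFree G → HasFullHom G C₅
  forbiddenFree⇒C₅ = ForbiddenFreeConnected.fullHom-C₅ G connected
  C₅⇒monochrome : HasFullHom G C₅ → IsMonochrome G
  C₅⇒monochrome = fullHom⇒monochrome G C₅ noHomogeneousTriple-C₅ connected
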